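{- Let $n\geq 3$. The set of permutations $\pi=\pi_1\cdots\pi_n\in\mathcal{S}_n$ such that $\pi$ avoids both $231$ and $1432$, $\pi^2$ avoids $231$, and $\pi_1=n$, is exactly $$\{\, n(n-1)\cdots(n-k+1)\,1\,2\cdots(n-k) \;:\; \lceil n/2\rceil\leq k\leq n-1\,\}.$$
   Context: $\mathcal{S}_n$ is the set of permutations of $[n]$, written as words with $\pi_i=\pi(i)$; $\pi^2=\pi\circ\pi$. A permutation contains a pattern $\sigma\in\mathcal{S}_k$ if some (not necessarily consecutive) subsequence of length $k$ is order isomorphic to $\sigma$; otherwise it avoids $\sigma$. The word $n(n-1)\cdots(n-k+1)12\cdots(n-k)$ denotes the permutation whose first $k$ entries are $n,n-1,\dots,n-k+1$ and whose last $n-k$ entries are $1,2,\dots,n-k$. -}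

module Defs where

open import Data.Nat using (ℕ; _∸_; _+_; _<?_)
open import Data.Fin using (Fin; toℕ; _<_)
open import Data.Fin.Permutation using (Permutation′; _⟨$⟩ʳ_)
open import Data.Vec using (Vec; lookup; _∷_; [])
open import Data.Product using (∃; _×_)
open import Relation.Nullary using (¬_; yes; no)

-- Permutations of [n] are represented 0-based: values in Fin n stand for 1..n.

Contains : ∀ {n k} → (Fin n → Fin n) → (Fin k → Fin k) → Set
Contains {n} {k} w σ =
  ∃ λ (ι : Fin k → Fin n) →
    (∀ a b → a < b → ι a < ι b) ×
    (∀ a b → (σ a < σ b → w (ι a) < w (ι b)) × (w (ι a) < w (ι b) → σ a < σ b))

Avoids : ∀ {n k} → (Fin n → Fin n) → (Fin k → Fin k) → Set
Avoids w σ = ¬ Contains w σ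

p231 : Fin 3 → Fin 3
p231 = lookup (suc zero ∷ suc (suc zero) ∷ zero ∷ [])
  where open Data.Fin using (zero; suc)

p1432 : Fin 4 → Fin 4
p1432 = lookup (zero ∷ suc (suc (suc zero)) ∷ suc (suc zero) ∷ suc zero ∷ [])
  where open Data.Fin using (zero; suc)

word : ∀ {n} → Permutation′ n → Fin n → Fin n
word π i = π ⟨$⟩ʳ i

square : ∀ {n} → Permutation′ n → Fin n → Fin n
square π i = π ⟨$⟩ʳ (π ⟨$⟩ʳ i)

-- 1-based value at 1-based position (toℕ i + 1) of the permutation
-- n (n-1) ⋯ (n-k+1) 1 2 ⋯ (n-k)
target : ℕ → ℕ → ℕ → ℕ
target n k i with i <? k
... | yes _ = n ∸ i
... | no _ = (i ∸ k) + 1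

-- Let π avoid 231 with π₁ = n, and let 1 sit at position m + 1. Any ascent before the 1
-- would form a 231 with it, so the prefix decreases; and π² takes its maximum n right at
-- the 1, so as π² avoids 231 it ascends across that position. Counting then shows
-- π(n) ≤ m, which forces every prefix entry above every suffix entry: the prefix is
-- n, n-1, …, n-m+1. The entry m + 1 lies in the prefix, whence n ≤ 2m, and the prefix
-- reflects any descent of the suffix into a 231 of π²: the suffix is 1, 2, …, n-m.
-- Conversely, every ascent of n(n-1)⋯(n-k+1)12⋯(n-k) lies in the increasing tail, which
-- rules out 231 and 1432, and its square is layered, reversing the positions 1, …, n-k
-- and k+1, …, n and fixing those in between, hence avoids 231.
module Submission where

open import Defs
open import Data.Nat as ℕ
  using (ℕ; zero; suc; pred; z≤n; s≤s; s≤s⁻¹; _≤_; _<_; _∸_; _+_; _<?_; _⊓_; ⌈_/2⌉)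
open import Data.Nat.Properties
open import Data.Fin as F using (Fin; toℕ)
open import Data.Fin.Properties
  using (opposite-prop; toℕ-fromℕ; toℕ-fromℕ<; toℕ<n; toℕ≤pred[n]; toℕ-injective; injective⇒≤)
open import Data.Fin.Permutation using (Permutation′; _⟨$⟩ʳ_; _⟨$⟩ˡ_; inverseˡ; inverseʳ)
open import Data.Vec using (lookup; _∷_; [])
open import Data.Product using (∃; ∃-syntax; _×_; _,_; proj₁; proj₂)
open import Data.Empty using (⊥-elim)
open import Data.Sum using (inj₁; inj₂)
open import Relation.Nullary using (¬_; yes; no)
open import Relation.Binary using (tri<; tri≈; tri>)
open import Function using (_∘_)
open import Function.Bundles using (Equivalence; _⇔_; mk⇔)
open import Relation.Binary.PropositionalEquality

Occurs231 : ∀ {n} → (Fin n → Fin n) → Set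
Occurs231 w = ∃[ i ] ∃[ j ] ∃[ l ] i F.< j × j F.< l × w i F.< w j × w l F.< w i

occurs⇒contains231 : ∀ {n} (w : Fin n → Fin n) → Occurs231 w → Contains w p231
occurs⇒contains231 w (i , j , l , i<j , j<l , wi<wj , wl<wi) = ι , increasing , isomorphic
  where
  open F using (zero; suc)
  ι : Fin 3 → Fin _
  ι = lookup (i ∷ j ∷ l ∷ [])
  irrefl : ∀ {A : Set} {x} → x < x → A
  irrefl x<x = ⊥-elim (<-irrefl refl x<x)
  increasing : ∀ a b → a F.< b → ι a F.< ι b
  increasing zero (suc zero) _ = i<j
  increasing zero (suc (suc zero)) _ = <-trans i<j j<l
  increasing (suc zero) (suc (suc zero)) _ = j<l
  increasing (suc zero) (suc zero) (s≤s ())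
  increasing (suc (suc zero)) (suc zero) (s≤s ())
  increasing (suc (suc zero)) (suc (suc zero)) (s≤s (s≤s ()))
  increasing _ zero ()
  isomorphic : ∀ a b → (p231 a F.< p231 b → w (ι a) F.< w (ι b)) ×
                       (w (ι a) F.< w (ι b) → p231 a F.< p231 b)
  isomorphic zero zero = irrefl , irrefl
  isomorphic zero (suc zero) = (λ _ → wi<wj) , (λ _ → s≤s (s≤s z≤n))
  isomorphic zero (suc (suc zero)) = (λ ()) , (λ h → ⊥-elim (<-asym h wl<wi))
  isomorphic (suc zero) zero = (λ { (s≤s ()) }) , (λ h → ⊥-elim (<-asym h wi<wj))
  isomorphic (suc zero) (suc zero) = irrefl , irrefl
  isomorphic (suc zero) (suc (suc zero)) = (λ ()) , (λ h → ⊥-elim (<-asym h (<-trans wl<wi wi<wj)))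
  isomorphic (suc (suc zero)) zero = (λ _ → wl<wi) , (λ _ → s≤s z≤n)
  isomorphic (suc (suc zero)) (suc zero) = (λ _ → <-trans wl<wi wi<wj) , (λ _ → s≤s z≤n)
  isomorphic (suc (suc zero)) (suc (suc zero)) = irrefl , irrefl

contains231⇒occurs : ∀ {n} (w : Fin n → Fin n) → Contains w p231 → Occurs231 w
contains231⇒occurs w (ι , increasing , isomorphic) =
  ι zero , ι one , ι two , increasing _ _ (s≤s z≤n) , increasing _ _ (s≤s (s≤s z≤n)) ,
  proj₁ (isomorphic zero one) (s≤s (s≤s z≤n)) , proj₁ (isomorphic two zero) (s≤s z≤n)
  where
  open F using (zero; suc)
  one two : Fin 3
  one = suc zero
  two = suc (suc zero)

contains1432⇒ascent-then-descent : ∀ {n} (w : Fin n → Fin n) → Contains w p1432 →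
  ∃[ i ] ∃[ j ] ∃[ l ] ∃[ o ] i F.< j × j F.< l × l F.< o × w i F.< w j × w o F.< w l
contains1432⇒ascent-then-descent w (ι , increasing , isomorphic) =
  ι zero , ι one , ι two , ι three ,
  increasing _ _ (s≤s z≤n) , increasing _ _ (s≤s (s≤s z≤n)) ,
  increasing _ _ (s≤s (s≤s (s≤s z≤n))) ,
  proj₁ (isomorphic zero one) (s≤s z≤n) , proj₁ (isomorphic three two) (s≤s (s≤s z≤n))
  where
  open F using (zero; suc)
  one two three : Fin 4
  one = suc zero
  two = suc (suc zero)
  three = suc (suc (suc zero))

module _ {n} (w : Fin n → Fin n) (k : ℕ) where

  DescentsBefore : Set
  DescentsBefore = ∀ i j → i F.< j → toℕ i < k → w j F.< w i

  AscentsFrom : Set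
  AscentsFrom = ∀ i j → k ≤ toℕ i → i F.< j → w i F.< w j

k≤start-of-ascent : ∀ {n} {w : Fin n → Fin n} {k} → DescentsBefore w k →
  ∀ {i j} → i F.< j → w i F.< w j → k ≤ toℕ i
k≤start-of-ascent {k = k} desc {i} {j} i<j wi<wj with toℕ i <? k
... | yes i<k = ⊥-elim (<-asym wi<wj (desc i j i<j i<k))
... | no i≮k = ≮⇒≥ i≮k

avoids231 : ∀ {n} {w : Fin n → Fin n} {k} → DescentsBefore w k → AscentsFrom w k → Avoids w p231
avoids231 {w = w} desc asc c with contains231⇒occurs w c
... | i , j , l , i<j , j<l , wi<wj , wl<wi =
  <-asym wl<wi (asc i l (k≤start-of-ascent desc i<j wi<wj) (<-trans i<j j<l))

avoids1432 : ∀ {n} {w : Fin n → Fin n} {k} → DescentsBefore w k → AscentsFrom w k → Avoids w p1432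
avoids1432 {w = w} desc asc c with contains1432⇒ascent-then-descent w c
... | i , j , l , o , i<j , j<l , l<o , wi<wj , wo<wl =
  <-asym wo<wl (asc l o (≤-trans (k≤start-of-ascent desc i<j wi<wj) (<⇒≤ (<-trans i<j j<l))) l<o)

∸-cancelˡ-< : ∀ n {x y} → n ∸ x < n ∸ y → y < x
∸-cancelˡ-< n {x} {y} lt with y <? x
... | yes y<x = y<x
... | no y≮x = ⊥-elim (<⇒≱ lt (∸-monoʳ-≤ n (≮⇒≥ y≮x)))

∸-≤-swap : ∀ {n i k} → k ≤ n → i ≤ n ∸ k → k ≤ n ∸ i
∸-≤-swap {n} {i} {k} k≤n i≤n∸k =
  m+n≤o⇒m≤o∸n k (subst (_≤ n) (+-comm i k) (m≤o∸n⇒m+n≤o i k≤n i≤n∸k))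

m<n⇒pred[n]<n : ∀ {m n} → m < n → pred n < n
m<n⇒pred[n]<n {n = suc n} _ = ≤-refl

m<n⇒n∸m≡1+[pred[n]∸m] : ∀ {m n} → m < n → n ∸ m ≡ suc (pred n ∸ m)
m<n⇒n∸m≡1+[pred[n]∸m] {n = suc n} m<n = +-∸-assoc 1 (s≤s⁻¹ m<n)

-- Strong induction along the block: the value at the previous position bounds f i from below,
-- the position carrying the value toℕ i ∸ a bounds it from above.
block-values : ∀ {N} (f : Fin N → ℕ) → (∀ v → v < N → ∃[ p ] f p ≡ v) → ∀ a b →
  (∀ i p → a ≤ toℕ i → toℕ i < b → f p < f i ⇔ (a ≤ toℕ p × p F.< i)) →
  ∀ i → a ≤ toℕ i → toℕ i < b → f i ≡ toℕ i ∸ a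
block-values {N} f onto a b block i = below (suc (toℕ i)) i ≤-refl
  where
  below : ∀ d i → toℕ i < d → a ≤ toℕ i → toℕ i < b → f i ≡ toℕ i ∸ a
  below zero _ ()
  below (suc d) i i<d a≤i i<b = ≤-antisym upper lower
    where
    to : ∀ p → f p < f i → a ≤ toℕ p × p F.< i
    to p = Equivalence.to (block i p a≤i i<b)
    from : ∀ p → a ≤ toℕ p × p F.< i → f p < f i
    from p = Equivalence.from (block i p a≤i i<b)
    earlier : ∀ p → a ≤ toℕ p → p F.< i → f p ≡ toℕ p ∸ a
    earlier p a≤p p<i = below d p (<-≤-trans p<i (s≤s⁻¹ i<d)) a≤p (<-trans p<i i<b)
    upper : f i ≤ toℕ i ∸ a
    upper with onto (toℕ i ∸ a) (≤-<-trans (m∸n≤m _ a) (toℕ<n i))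
    ... | p , fp≡ with f p <? f i
    ...   | no fp≮fi = subst (f i ≤_) fp≡ (≮⇒≥ fp≮fi)
    ...   | yes fp<fi = ⊥-elim (<-irrefl fp≡
                      (subst (_< toℕ i ∸ a) (sym (earlier p a≤p p<i)) (∸-monoˡ-< p<i a≤p)))
      where
      a≤p : a ≤ toℕ p
      a≤p = proj₁ (to p fp<fi)
      p<i : p F.< i
      p<i = proj₂ (to p fp<fi)
    lower : toℕ i ∸ a ≤ f i
    lower with m≤n⇒m<n∨m≡n a≤i
    ... | inj₂ a≡i = subst (_≤ f i) (trans (sym (n∸n≡0 a)) (cong (_∸ a) a≡i)) z≤n
    ... | inj₁ a<i = begin
      toℕ i ∸ a               ≡⟨ m<n⇒n∸m≡1+[pred[n]∸m] a<i ⟩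
      suc (pred (toℕ i) ∸ a)  ≡⟨ cong (λ x → suc (x ∸ a)) (sym (toℕ-fromℕ< q<N)) ⟩
      suc (toℕ q ∸ a)         ≡⟨ cong suc (sym (earlier q a≤q q<i)) ⟩
      suc (f q)               ≤⟨ from q (a≤q , q<i) ⟩
      f i                     ∎
      where
      open ≤-Reasoning
      q<N : pred (toℕ i) < N
      q<N = ≤-<-trans pred[n]≤n (toℕ<n i)
      q : Fin N
      q = F.fromℕ< q<N
      q<i : q F.< i
      q<i = subst (_< toℕ i) (sym (toℕ-fromℕ< q<N)) (m<n⇒pred[n]<n a<i)
      a≤q : a ≤ toℕ q
      a≤q = subst (a ≤_) (sym (toℕ-fromℕ< q<N)) (<⇒≤pred a<i)

-- Pigeonhole: b ↦ f b injects the N ∸ m positions from m on into the N ∸ suc s values above s.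
injective-above-from⇒< : ∀ {N} (f : Fin N → Fin N) → (∀ {i j} → f i ≡ f j → i ≡ j) →
  ∀ m s → m < N → (∀ b → m ≤ toℕ b → s < toℕ (f b)) → s < m
injective-above-from⇒< {N} f f-injective m s m<N above with s <? m
... | yes s<m = s<m
... | no s≮m = ⊥-elim (<-irrefl refl (begin-strict
  N ∸ m      ≤⟨ injective⇒≤ h-injective ⟩
  N ∸ suc s  ≤⟨ ∸-monoʳ-≤ N (s≤s (≮⇒≥ s≮m)) ⟩
  N ∸ suc m  <⟨ ∸-monoʳ-< ≤-refl m<N ⟩
  N ∸ m      ∎))
  where
  open ≤-Reasoning
  shifted< : (b : Fin (N ∸ m)) → m + toℕ b < N
  shifted< b = subst (m + toℕ b <_) (m+[n∸m]≡n (<⇒≤ m<N)) (+-monoʳ-< m (toℕ<n b))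
  shift : Fin (N ∸ m) → Fin N
  shift b = F.fromℕ< (shifted< b)
  shift-above : ∀ b → s < toℕ (f (shift b))
  shift-above b = above (shift b) (subst (m ≤_) (sym (toℕ-fromℕ< (shifted< b))) (m≤m+n m _))
  h : Fin (N ∸ m) → Fin (N ∸ suc s)
  h b = F.fromℕ< (∸-monoˡ-< (toℕ<n (f (shift b))) (shift-above b))
  h-injective : ∀ {b c} → h b ≡ h c → b ≡ c
  h-injective {b} {c} hb≡hc = toℕ-injective (+-cancelˡ-≡ m _ _ (begin-equality
    m + toℕ b              ≡⟨ toℕ-fromℕ< (shifted< b) ⟨
    toℕ (shift b)          ≡⟨ cong toℕ (f-injective (toℕ-injective f-shift-b≡f-shift-c)) ⟩
    toℕ (shift c)          ≡⟨ toℕ-fromℕ< (shifted< c) ⟩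
    m + toℕ c              ∎))
    where
    f-shift-b≡f-shift-c : toℕ (f (shift b)) ≡ toℕ (f (shift c))
    f-shift-b≡f-shift-c = ∸-cancelʳ-≡ (shift-above b) (shift-above c)
      (trans (sym (toℕ-fromℕ< _)) (trans (cong toℕ hb≡hc) (toℕ-fromℕ< _)))

module _ {n} (π : Permutation′ n) where

  ⟨$⟩ʳ-injective : ∀ {i j} → π ⟨$⟩ʳ i ≡ π ⟨$⟩ʳ j → i ≡ j
  ⟨$⟩ʳ-injective {i} {j} πi≡πj = begin
    i                    ≡⟨ inverseˡ π ⟨
    π ⟨$⟩ˡ (π ⟨$⟩ʳ i)    ≡⟨ cong (π ⟨$⟩ˡ_) πi≡πj ⟩
    π ⟨$⟩ˡ (π ⟨$⟩ʳ j)    ≡⟨ inverseˡ π ⟩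
    j                    ∎
    where open ≡-Reasoning

  word-injective : ∀ {i j} → toℕ (word π i) ≡ toℕ (word π j) → i ≡ j
  word-injective eq = ⟨$⟩ʳ-injective (toℕ-injective eq)

  square-injective : ∀ {i j} → square π i ≡ square π j → i ≡ j
  square-injective eq = ⟨$⟩ʳ-injective (⟨$⟩ʳ-injective eq)

  word-≯⇒< : ∀ {i j} → i ≢ j → ¬ (word π j F.< word π i) → word π i F.< word π j
  word-≯⇒< i≢j ≯ = ≤∧≢⇒< (≮⇒≥ ≯) (λ eq → i≢j (word-injective eq))

  square-≯⇒< : ∀ {i j} → i ≢ j → ¬ (square π j F.< square π i) → square π i F.< square π j
  square-≯⇒< i≢j ≯ = ≤∧≢⇒< (≮⇒≥ ≯) (λ eq → i≢j (square-injective (toℕ-injective eq)))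

  word-onto : ∀ v → (v<n : v < n) → toℕ (word π (π ⟨$⟩ˡ F.fromℕ< v<n)) ≡ v
  word-onto v v<n = trans (cong toℕ (inverseʳ π)) (toℕ-fromℕ< v<n)

n≤k+k⇒⌈n/2⌉≤k : ∀ {n k} → n ≤ k + k → ⌈ n /2⌉ ≤ k
n≤k+k⇒⌈n/2⌉≤k {k = k} n≤k+k =
  subst (⌈ _ /2⌉ ≤_) (sym (n≡⌈n+n/2⌉ k)) (⌈n/2⌉-mono n≤k+k)

⌈n/2⌉≤k⇒n≤k+k : ∀ {n k} → ⌈ n /2⌉ ≤ k → n ≤ k + k
⌈n/2⌉≤k⇒n≤k+k {n} ⌈n/2⌉≤k =
  subst (_≤ _) (⌊n/2⌋+⌈n/2⌉≡n n) (+-mono-≤ (≤-trans (⌊n/2⌋≤⌈n/2⌉ n) ⌈n/2⌉≤k) ⌈n/2⌉≤k)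

target-head : ∀ {n₁ k i} → i < k → i ≤ n₁ → target (suc n₁) k i ≡ suc (n₁ ∸ i)
target-head {k = k} {i} i<k i≤n₁ with i <? k
... | yes _ = +-∸-assoc 1 i≤n₁
... | no i≮k = ⊥-elim (i≮k i<k)

target-tail : ∀ {n k i} → k ≤ i → target n k i ≡ suc (i ∸ k)
target-tail {k = k} {i} k≤i with i <? k
... | yes i<k = ⊥-elim (<⇒≱ i<k k≤i)
... | no _ = +-comm (i ∸ k) 1

module Forward (n₁ : ℕ) (1≤n₁ : 1 ≤ n₁) (π : Permutation′ (suc n₁))
  (π-avoids-231 : Avoids (word π) p231) (π²-avoids-231 : Avoids (square π) p231)
  (first-is-max : toℕ (word π F.zero) ≡ n₁) where

  val : Fin (suc n₁) → ℕ
  val i = toℕ (word π i)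

  sq : Fin (suc n₁) → ℕ
  sq i = toℕ (square π i)

  z : Fin (suc n₁)
  z = π ⟨$⟩ˡ F.zero

  m : ℕ
  m = toℕ z

  val-z : val z ≡ 0
  val-z = cong toℕ (inverseʳ π)

  val-pos : ∀ {i} → toℕ i ≢ m → 0 < val i
  val-pos i≢z = n≢0⇒n>0 (λ vi≡0 → i≢z (cong toℕ (word-injective π (trans vi≡0 (sym val-z)))))

  0<m : 0 < m
  0<m = n≢0⇒n>0 λ m≡0 → <⇒≢ 1≤n₁ (sym (begin-equality
    n₁           ≡⟨ first-is-max ⟨
    val F.zero   ≡⟨ cong val (toℕ-injective m≡0) ⟨
    val z        ≡⟨ val-z ⟩
    0            ∎))
    where open ≤-Reasoning

  sq-z : sq z ≡ n₁
  sq-z = trans (cong val (inverseʳ π)) first-is-max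

  prefix-descends : ∀ i j → i F.< j → toℕ j < m → word π j F.< word π i
  prefix-descends i j i<j j<m =
    word-≯⇒< π (λ j≡i → <-irrefl (cong toℕ (sym j≡i)) i<j) λ vi<vj →
    π-avoids-231 (occurs⇒contains231 (word π)
      (i , j , z , i<j , j<m , vi<vj , subst (_< val i) (sym val-z) (val-pos (<⇒≢ (<-trans i<j j<m)))))

  square-below-z : ∀ a → toℕ a ≢ m → square π a F.< square π z
  square-below-z a a≢z = subst (sq a <_) (sym sq-z) (≤∧≢⇒< (toℕ≤pred[n] (square π a)) λ sqa≡n₁ →
    a≢z (cong toℕ (square-injective π (toℕ-injective (trans sqa≡n₁ (sym sq-z))))))

  square-ascends-across : ∀ a b → toℕ a < m → m < toℕ b → square π a F.< square π b
  square-ascends-across a b a<m m<b =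
    square-≯⇒< π (λ a≡b → <-asym a<m (subst (m <_) (cong toℕ (sym a≡b)) m<b)) λ sqb<sqa →
      π²-avoids-231 (occurs⇒contains231 (square π)
        (a , z , b , a<m , m<b , square-below-z a (<⇒≢ a<m) , sqb<sqa))

  -- Counting: the positions z, …, n₁ all carry larger π²-values than a.
  square-below-m : ∀ a → toℕ a < m → sq a < m
  square-below-m a a<m = injective-above-from⇒< (square π) (square-injective π) m (sq a) (toℕ<n z) above
    where
    above : ∀ b → m ≤ toℕ b → sq a < sq b
    above b m≤b with m≤n⇒m<n∨m≡n m≤b
    ... | inj₁ m<b = square-ascends-across a b a<m m<b
    ... | inj₂ m≡b = subst (λ c → sq a < sq c) (toℕ-injective m≡b) (square-below-z a (<⇒≢ a<m))

  -- If π(a) < π(p), then for the position q just before z we get π(q) < π(last) < m, so π²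
  -- descends from q to the last position, across z.
  prefix-above-suffix : ∀ a p → toℕ a < m → m < toℕ p → word π p F.< word π a
  prefix-above-suffix a p a<m m<p =
    word-≯⇒< π (λ p≡a → <-asym a<m (subst (m <_) (cong toℕ p≡a) m<p)) λ va<vp →
      <-asym (square-ascends-across q last q<m (subst (m <_) (sym (toℕ-fromℕ n₁)) m<n₁))
             (prefix-descends (π ⟨$⟩ʳ q) (π ⟨$⟩ʳ last)
               (vq<vlast (≤-<-trans vq≤va va<vp)) vlast<m)
    where
    last : Fin (suc n₁)
    last = F.fromℕ n₁
    m<n₁ : m < n₁
    m<n₁ = <-≤-trans m<p (toℕ≤pred[n] p)
    q<N : pred m < suc n₁
    q<N = ≤-<-trans pred[n]≤n (toℕ<n z)
    q : Fin (suc n₁)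
    q = F.fromℕ< q<N
    q<m : toℕ q < m
    q<m = subst (_< m) (sym (toℕ-fromℕ< q<N)) (m<n⇒pred[n]<n 0<m)
    vq≤va : val q ≤ val a
    vq≤va with m≤n⇒m<n∨m≡n (<⇒≤pred a<m)
    ... | inj₁ a<pm = <⇒≤ (prefix-descends a q (subst (toℕ a <_) (sym (toℕ-fromℕ< q<N)) a<pm) q<m)
    ... | inj₂ a≡pm = ≤-reflexive (cong val (toℕ-injective (trans (toℕ-fromℕ< q<N) (sym a≡pm))))
    vq<vlast : val q < val p → val q < val last
    vq<vlast vq<vp with m≤n⇒m<n∨m≡n (toℕ≤pred[n] p)
    ... | inj₂ p≡n₁ =
      subst (λ c → val q < val c) (toℕ-injective (trans p≡n₁ (sym (toℕ-fromℕ n₁)))) vq<vp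
    ... | inj₁ p<n₁ = word-≯⇒< π q≢last λ vlast<vq →
      π-avoids-231 (occurs⇒contains231 (word π)
        (q , p , last , <-trans q<m m<p , subst (toℕ p <_) (sym (toℕ-fromℕ n₁)) p<n₁ ,
         vq<vp , vlast<vq))
      where
      q≢last : q ≢ last
      q≢last q≡last = <-irrefl (trans (cong toℕ q≡last) (toℕ-fromℕ n₁)) (<-trans q<m m<n₁)
    vlast<m : val last < m
    vlast<m = subst (_< m) (cong val π-zero) (square-below-m F.zero 0<m)
      where
      π-zero : π ⟨$⟩ʳ F.zero ≡ last
      π-zero = toℕ-injective (trans first-is-max (sym (toℕ-fromℕ n₁)))

  descents-before : DescentsBefore (word π) m
  descents-before i j i<j i<m with <-cmp (toℕ j) m
  ... | tri< j<m _ _ = prefix-descends i j i<j j<m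
  ... | tri≈ _ j≡m _ = subst (λ c → val c < val i) (sym (toℕ-injective j≡m))
                         (subst (_< val i) (sym val-z) (val-pos (<⇒≢ i<m)))
  ... | tri> _ _ m<j = prefix-above-suffix i j i<m m<j

  prefix-values : ∀ i → toℕ i < m → val i ≡ n₁ ∸ toℕ i
  prefix-values i i<m = begin-equality
    val i                  ≡⟨ m∸[m∸n]≡n (toℕ≤pred[n] (word π i)) ⟨
    n₁ ∸ (n₁ ∸ val i)      ≡⟨ cong (n₁ ∸_) (block-values co-val onto 0 m block i z≤n i<m) ⟩
    n₁ ∸ toℕ i             ∎
    where
    open ≤-Reasoning
    co-val : Fin (suc n₁) → ℕ
    co-val p = n₁ ∸ val p
    onto : ∀ v → v < suc n₁ → ∃[ p ] co-val p ≡ v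
    onto v v<N = π ⟨$⟩ˡ F.fromℕ< n₁∸v<N ,
      trans (cong (n₁ ∸_) (word-onto π (n₁ ∸ v) n₁∸v<N)) (m∸[m∸n]≡n (s≤s⁻¹ v<N))
      where
      n₁∸v<N : n₁ ∸ v < suc n₁
      n₁∸v<N = s≤s (m∸n≤m n₁ v)
    block : ∀ i p → 0 ≤ toℕ i → toℕ i < m → co-val p < co-val i ⇔ (0 ≤ toℕ p × p F.< i)
    block i p _ i<m = mk⇔ earlier λ (_ , p<i) →
      ∸-monoʳ-< (descents-before p i p<i (<-trans p<i i<m)) (toℕ≤pred[n] (word π p))
      where
      earlier : co-val p < co-val i → 0 ≤ toℕ p × p F.< i
      earlier lt with <-cmp (toℕ p) (toℕ i)
      ... | tri< p<i _ _ = z≤n , p<i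
      ... | tri≈ _ p≡i _ = ⊥-elim (<-irrefl (cong co-val (toℕ-injective p≡i)) lt)
      ... | tri> _ _ i<p = ⊥-elim (<-asym (∸-cancelˡ-< n₁ lt) (descents-before i p i<p i<m))

  r : Fin (suc n₁)
  r = π ⟨$⟩ˡ z

  val-r : val r ≡ m
  val-r = cong toℕ (inverseʳ π)

  n≤m+m : suc n₁ ≤ m + m
  n≤m+m with <-cmp (toℕ r) m
  ... | tri< r<m _ _ = begin
    suc n₁                    ≡⟨ cong suc (m∸n+n≡m (toℕ≤pred[n] r)) ⟨
    suc (n₁ ∸ toℕ r + toℕ r)  ≡⟨ cong (λ x → suc (x + toℕ r)) (prefix-values r r<m) ⟨
    suc (val r + toℕ r)       ≡⟨ cong (λ x → suc (x + toℕ r)) val-r ⟩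
    suc (m + toℕ r)           ≡⟨ +-suc m (toℕ r) ⟨
    m + suc (toℕ r)           ≤⟨ +-monoʳ-≤ m r<m ⟩
    m + m                     ∎
    where open ≤-Reasoning
  ... | tri≈ _ r≡m _ = ⊥-elim (<⇒≢ 0<m (begin-equality
    0      ≡⟨ val-z ⟨
    val z  ≡⟨ cong val (toℕ-injective r≡m) ⟨
    val r  ≡⟨ val-r ⟩
    m      ∎))
    where open ≤-Reasoning
  ... | tri> _ _ m<r = ⊥-elim (n≮0 (subst (sq F.zero <_) sq-r (square-ascends-across F.zero r 0<m m<r)))
    where
    sq-r : sq r ≡ 0
    sq-r = trans (cong val (inverseʳ π)) val-z

  -- At the reflected positions n₁ ∸ p, π² takes the values π(p); so a descent of the suffix,
  -- followed by the reflection of z, would give a 231 in π².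
  suffix-ascends : ∀ i j → m < toℕ i → i F.< j → word π i F.< word π j
  suffix-ascends i j m<i i<j = word-≯⇒< π (λ i≡j → <-irrefl (cong toℕ i≡j) i<j) λ vj<vi →
    π²-avoids-231 (occurs⇒contains231 (square π)
      (F.opposite j , F.opposite i , F.opposite z ,
       opposite-< i<j (toℕ≤pred[n] j) , opposite-< m<i (toℕ≤pred[n] i) ,
       subst₂ _<_ (sym sq-opposite-j) (sym sq-opposite-i) vj<vi ,
       subst₂ _<_ (sym sq-opposite-z) (sym sq-opposite-j) 0<vj))
    where
    0<vj : 0 < val j
    0<vj = val-pos (<⇒≢ (<-trans m<i i<j) ∘ sym)
    opposite-< : ∀ {p q} → p F.< q → toℕ q ≤ n₁ → F.opposite q F.< F.opposite p
    opposite-< {p} {q} p<q q≤n₁ =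
      subst₂ _<_ (sym (opposite-prop q)) (sym (opposite-prop p)) (∸-monoʳ-< p<q q≤n₁)
    opposite-below-m : ∀ p → m ≤ toℕ p → toℕ (F.opposite p) < m
    opposite-below-m p m≤p = subst (_< m) (sym (opposite-prop p))
      (≤-<-trans (∸-monoʳ-≤ n₁ m≤p) (m<n+o⇒m∸n<o n₁ m {{ℕ.>-nonZero 0<m}} n≤m+m))
    square-opposite : ∀ p → m ≤ toℕ p → sq (F.opposite p) ≡ val p
    square-opposite p m≤p = cong val (toℕ-injective (begin-equality
      val (F.opposite p)              ≡⟨ prefix-values (F.opposite p) (opposite-below-m p m≤p) ⟩
      n₁ ∸ toℕ (F.opposite p)         ≡⟨ cong (n₁ ∸_) (opposite-prop p) ⟩
      n₁ ∸ (n₁ ∸ toℕ p)               ≡⟨ m∸[m∸n]≡n (toℕ≤pred[n] p) ⟩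
      toℕ p                           ∎))
      where open ≤-Reasoning
    sq-opposite-i : sq (F.opposite i) ≡ val i
    sq-opposite-i = square-opposite i (<⇒≤ m<i)
    sq-opposite-j : sq (F.opposite j) ≡ val j
    sq-opposite-j = square-opposite j (<⇒≤ (<-trans m<i i<j))
    sq-opposite-z : sq (F.opposite z) ≡ 0
    sq-opposite-z = trans (square-opposite z ≤-refl) val-z

  ascents-from : AscentsFrom (word π) m
  ascents-from i j m≤i i<j with m≤n⇒m<n∨m≡n m≤i
  ... | inj₁ m<i = suffix-ascends i j m<i i<j
  ... | inj₂ m≡i = subst (λ c → val c < val j) (toℕ-injective m≡i)
                     (subst (_< val j) (sym val-z) (val-pos (<⇒≢ (≤-<-trans m≤i i<j) ∘ sym)))

  suffix-values : ∀ i → m ≤ toℕ i → val i ≡ toℕ i ∸ m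
  suffix-values i m≤i = block-values val onto m (suc n₁) block i m≤i (toℕ<n i)
    where
    onto : ∀ v → v < suc n₁ → ∃[ p ] val p ≡ v
    onto v v<N = π ⟨$⟩ˡ F.fromℕ< v<N , word-onto π v v<N
    block : ∀ i p → m ≤ toℕ i → toℕ i < suc n₁ → val p < val i ⇔ (m ≤ toℕ p × p F.< i)
    block i p m≤i _ = mk⇔ earlier (λ (m≤p , p<i) → ascents-from p i m≤p p<i)
      where
      earlier : val p < val i → m ≤ toℕ p × p F.< i
      earlier lt with <-cmp (toℕ p) (toℕ i)
      ... | tri≈ _ p≡i _ = ⊥-elim (<-irrefl (cong val (toℕ-injective p≡i)) lt)
      ... | tri> _ _ i<p = ⊥-elim (<-asym lt (ascents-from i p m≤i i<p))
      ... | tri< p<i _ _ with toℕ p <? m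
      ...   | yes p<m = ⊥-elim (<-asym lt (descents-before p i p<i p<m))
      ...   | no p≮m = ≮⇒≥ p≮m , p<i

  is-target : ∃[ k ] ⌈ suc n₁ /2⌉ ≤ k × k ≤ n₁ × (∀ i → suc (val i) ≡ target (suc n₁) k (toℕ i))
  is-target = m , n≤k+k⇒⌈n/2⌉≤k n≤m+m , toℕ≤pred[n] z , values
    where
    values : ∀ i → suc (val i) ≡ target (suc n₁) m (toℕ i)
    values i with <-≤-connex (toℕ i) m
    ... | inj₁ i<m = trans (cong suc (prefix-values i i<m)) (sym (target-head i<m (toℕ≤pred[n] i)))
    ... | inj₂ m≤i = trans (cong suc (suffix-values i m≤i)) (sym (target-tail m≤i))

module Backward (n₁ k : ℕ) (k≤n₁ : k ≤ n₁) (n≤k+k : suc n₁ ≤ k + k)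
  (π : Permutation′ (suc n₁))
  (is-target : ∀ i → suc (toℕ (word π i)) ≡ target (suc n₁) k (toℕ i)) where

  val : Fin (suc n₁) → ℕ
  val i = toℕ (word π i)

  sq : Fin (suc n₁) → ℕ
  sq i = toℕ (square π i)

  0<k : 0 < k
  0<k = n≢0⇒n>0 λ { refl → n≮0 n≤k+k }

  n₁∸k<k : n₁ ∸ k < k
  n₁∸k<k = m<n+o⇒m∸n<o n₁ k {{ℕ.>-nonZero 0<k}} n≤k+k

  head-values : ∀ i → toℕ i < k → val i ≡ n₁ ∸ toℕ i
  head-values i i<k = suc-injective (trans (is-target i) (target-head i<k (toℕ≤pred[n] i)))

  tail-values : ∀ i → k ≤ toℕ i → val i ≡ toℕ i ∸ k
  tail-values i k≤i = suc-injective (trans (is-target i) (target-tail k≤i))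

  first-is-max : ∀ i → toℕ i ≡ 0 → suc (val i) ≡ suc n₁
  first-is-max i i≡0 =
    cong suc (trans (head-values i (subst (_< k) (sym i≡0) 0<k)) (cong (n₁ ∸_) i≡0))

  descents-before : DescentsBefore (word π) k
  descents-before i j i<j i<k with <-≤-connex (toℕ j) k
  ... | inj₁ j<k = subst₂ _<_ (sym (head-values j j<k)) (sym (head-values i i<k))
                     (∸-monoʳ-< i<j (toℕ≤pred[n] j))
  ... | inj₂ k≤j = subst₂ _<_ (sym (tail-values j k≤j)) (sym (head-values i i<k))
                     (≤-<-trans (∸-monoˡ-≤ k (toℕ≤pred[n] j)) (∸-monoʳ-< i<k k≤n₁))

  ascents-from : AscentsFrom (word π) k
  ascents-from i j k≤i i<j =
    subst₂ _<_ (sym (tail-values i k≤i)) (sym (tail-values j (≤-trans k≤i (<⇒≤ i<j))))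
      (∸-monoˡ-< i<j k≤i)

  low-square : ∀ i → toℕ i ≤ n₁ ∸ k → sq i ≡ n₁ ∸ toℕ i ∸ k
  low-square i i≤n₁∸k = trans (tail-values (π ⟨$⟩ʳ i) k≤vi) (cong (_∸ k) (head-values i i<k))
    where
    i<k : toℕ i < k
    i<k = ≤-<-trans i≤n₁∸k n₁∸k<k
    k≤vi : k ≤ val i
    k≤vi = subst (k ≤_) (sym (head-values i i<k)) (∸-≤-swap k≤n₁ i≤n₁∸k)

  middle-square : ∀ i → n₁ ∸ k < toℕ i → toℕ i < k → sq i ≡ toℕ i
  middle-square i n₁∸k<i i<k = begin-equality
    sq i               ≡⟨ head-values (π ⟨$⟩ʳ i) vi<k ⟩
    n₁ ∸ val i         ≡⟨ cong (n₁ ∸_) (head-values i i<k) ⟩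
    n₁ ∸ (n₁ ∸ toℕ i)  ≡⟨ m∸[m∸n]≡n (toℕ≤pred[n] i) ⟩
    toℕ i              ∎
    where
    open ≤-Reasoning
    vi<k : val i < k
    vi<k = ≰⇒> λ k≤vi →
      <⇒≱ n₁∸k<i (∸-≤-swap (toℕ≤pred[n] i) (subst (k ≤_) (head-values i i<k) k≤vi))

  high-square : ∀ i → k ≤ toℕ i → sq i ≡ n₁ ∸ (toℕ i ∸ k)
  high-square i k≤i = trans (head-values (π ⟨$⟩ʳ i) vi<k) (cong (n₁ ∸_) (tail-values i k≤i))
    where
    vi<k : val i < k
    vi<k = subst (_< k) (sym (tail-values i k≤i))
      (≤-<-trans (∸-monoˡ-≤ k (toℕ≤pred[n] i)) n₁∸k<k)

  square-beyond-low : ∀ l → n₁ ∸ k < toℕ l → toℕ l ⊓ k ≤ sq l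
  square-beyond-low l n₁∸k<l with <-≤-connex (toℕ l) k
  ... | inj₁ l<k = subst (toℕ l ⊓ k ≤_) (sym (middle-square l n₁∸k<l l<k)) (m⊓n≤m (toℕ l) k)
  ... | inj₂ k≤l = ≤-trans (m⊓n≤n (toℕ l) k) (subst (k ≤_) (sym (high-square l k≤l)) (begin
    k                        ≡⟨ m∸[m∸n]≡n k≤n₁ ⟨
    n₁ ∸ (n₁ ∸ k)            ≤⟨ ∸-monoʳ-≤ n₁ (∸-monoˡ-≤ k (toℕ≤pred[n] l)) ⟩
    n₁ ∸ (toℕ l ∸ k)         ∎))
    where open ≤-Reasoning

  low-square≤ : ∀ i → toℕ i ≤ n₁ ∸ k → sq i ≤ n₁ ∸ k
  low-square≤ i i≤n₁∸k = subst (_≤ n₁ ∸ k) (sym (low-square i i≤n₁∸k)) (∸-monoˡ-≤ k (m∸n≤m n₁ (toℕ i)))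

  low-square-descends : ∀ i j → i F.< j → toℕ j ≤ n₁ ∸ k → sq j < sq i
  low-square-descends i j i<j j≤n₁∸k =
    subst₂ _<_ (sym (low-square j j≤n₁∸k)) (sym (low-square i (≤-trans (<⇒≤ i<j) j≤n₁∸k)))
      (∸-monoˡ-< (∸-monoʳ-< i<j (toℕ≤pred[n] j)) (∸-≤-swap k≤n₁ j≤n₁∸k))

  high-square-descends : ∀ i j → k ≤ toℕ i → i F.< j → sq j < sq i
  high-square-descends i j k≤i i<j =
    subst₂ _<_ (sym (high-square j (≤-trans k≤i (<⇒≤ i<j)))) (sym (high-square i k≤i))
      (∸-monoʳ-< (∸-monoˡ-< i<j k≤i) (≤-trans (m∸n≤m (toℕ j) k) (toℕ≤pred[n] j)))

  square-avoids-231 : Avoids (square π) p231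
  square-avoids-231 c with contains231⇒occurs (square π) c
  ... | i , j , l , i<j , j<l , sqi<sqj , sql<sqi
      with <-≤-connex (n₁ ∸ k) (toℕ i) | <-≤-connex (toℕ i) k
  ... | _ | inj₂ k≤i = <-asym sqi<sqj (high-square-descends i j k≤i i<j)
  ... | inj₁ n₁∸k<i | inj₁ i<k = <-asym sql<sqi (begin-strict
    sq i        ≡⟨ middle-square i n₁∸k<i i<k ⟩
    toℕ i       <⟨ ⊓-glb (<-trans i<j j<l) i<k ⟩
    toℕ l ⊓ k   ≤⟨ square-beyond-low l (<-trans n₁∸k<i (<-trans i<j j<l)) ⟩
    sq l        ∎)
    where open ≤-Reasoning
  ... | inj₂ i≤n₁∸k | _ with <-≤-connex (n₁ ∸ k) (toℕ j)
  ...   | inj₂ j≤n₁∸k = <-asym sqi<sqj (low-square-descends i j i<j j≤n₁∸k)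
  ...   | inj₁ n₁∸k<j = <-asym sql<sqi (begin-strict
    sq i        ≤⟨ low-square≤ i i≤n₁∸k ⟩
    n₁ ∸ k      <⟨ ⊓-glb (<-trans n₁∸k<j j<l) n₁∸k<k ⟩
    toℕ l ⊓ k   ≤⟨ square-beyond-low l (<-trans n₁∸k<j j<l) ⟩
    sq l        ∎)
    where open ≤-Reasoning

lemma2p3 : (n : ℕ) → 3 ≤ n → (π : Permutation′ n) →
    ((Avoids (word π) p231 × Avoids (word π) p1432 × Avoids (square π) p231 ×
      (∀ (i : Fin n) → toℕ i ≡ 0 → suc (toℕ (π ⟨$⟩ʳ i)) ≡ n))
    ⇔
    (∃ λ (k : ℕ) → ⌈ n /2⌉ ≤ k × k ≤ n ∸ 1 ×
      (∀ (i : Fin n) → suc (toℕ (π ⟨$⟩ʳ i)) ≡ target n k (toℕ i))))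
lemma2p3 (suc n₁) (s≤s 2≤n₁) π = mk⇔
  (λ (π-avoids-231 , _ , π²-avoids-231 , first-is-max) →
    Forward.is-target n₁ (≤-trans (s≤s z≤n) 2≤n₁) π π-avoids-231 π²-avoids-231
      (suc-injective (first-is-max F.zero refl)))
  (λ (k , ⌈n/2⌉≤k , k≤n₁ , is-target) →
    let open Backward n₁ k k≤n₁ (⌈n/2⌉≤k⇒n≤k+k {k = k} ⌈n/2⌉≤k) π is-target in
    avoids231 descents-before ascents-from , avoids1432 descents-before ascents-from ,
    square-avoids-231 , first-is-max)
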